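{- Let $G=(V,E)$ be a connected regular graph of even order $n$, and let $\{V_1,V_2\}$ be a partition of $V$ with $|V_1|=|V_2|=n/2$. (i) If the subgraphs of $G$ induced by $V_1$ and by $V_2$ are both 1-factorable, then $G$ is 1-factorable. (ii) If $V_1$ is a clique or a coclique in $G$, then $G$ is class 1.
   Context: A graph is 1-factorable if its edge set can be partitioned into perfect matchings (1-factors). A graph of maximum degree $\Delta$ is class 1 if its chromatic index (minimum number of colours in a proper edge-colouring) equals $\Delta$. A clique is a set of pairwise adjacent vertices; a coclique is a set of pairwise non-adjacent vertices. -}

module Defs where

open import Data.Nat using (ℕ; _≤_; _⊔_)
open import Data.Bool using (Bool; true; false; _≟_)
open import Data.Fin using (Fin)
open import Data.Fin.Subset using (Subset; _∈_)
open import Data.List using (List; length; filter; map; foldr; allFin)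
open import Data.Product using (Σ; ∃; _×_; _,_; proj₁)
open import Relation.Binary.PropositionalEquality using (_≡_; _≢_)

record Graph (V : Set) : Set where
  field
    adj    : V → V → Bool
    sym    : ∀ u v → adj u v ≡ adj v u
    irrefl : ∀ v → adj v v ≡ false
open Graph public

data Reach {V : Set} (G : Graph V) : V → V → Set where
  here : ∀ {v} → Reach G v v
  step : ∀ {u v w} → adj G u v ≡ true → Reach G v w → Reach G u w

Connected : {V : Set} → Graph V → Set
Connected {V} G = ∀ (u v : V) → Reach G u v

degree : ∀ {n} → Graph (Fin n) → Fin n → ℕ
degree {n} G v = length (filter (λ u → adj G v u ≟ true) (allFin n))

maxDegree : ∀ {n} → Graph (Fin n) → ℕ
maxDegree {n} G = foldr _⊔_ 0 (map (degree G) (allFin n))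

Regular : ∀ {n} → Graph (Fin n) → Set
Regular {n} G = ∃ λ d → ∀ (v : Fin n) → degree G v ≡ d

induced : ∀ {n} → Graph (Fin n) → (S : Subset n) → Graph (Σ (Fin n) (λ v → v ∈ S))
induced G S = record
  { adj    = λ u v → adj G (proj₁ u) (proj₁ v)
  ; sym    = λ u v → sym G (proj₁ u) (proj₁ v)
  ; irrefl = λ v → irrefl G (proj₁ v) }

-- A symmetric assignment of colours in Fin k to the edges of G
-- (values on non-edges are irrelevant).
record EdgeColouring {V : Set} (G : Graph V) (k : ℕ) : Set where
  field
    col    : V → V → Fin k
    col-sym : ∀ u v → adj G u v ≡ true → col u v ≡ col v u
open EdgeColouring public

Proper : ∀ {V k} {G : Graph V} → EdgeColouring G k → Set
Proper {V} {k} {G} c = ∀ u v w → adj G u v ≡ true → adj G u w ≡ true → v ≢ w →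
  col c u v ≢ col c u w

PerfectMatchingClass : ∀ {V k} {G : Graph V} → EdgeColouring G k → Fin k → Set
PerfectMatchingClass {V} {k} {G} c i = ∀ (v : V) →
  Σ V λ u → (adj G v u ≡ true × col c v u ≡ i) ×
    (∀ w → adj G v w ≡ true → col c v w ≡ i → w ≡ u)

OneFactorable : {V : Set} → Graph V → Set
OneFactorable G = Σ ℕ λ k → Σ (EdgeColouring G k) λ c → ∀ i → PerfectMatchingClass c i

EdgeColourable : {V : Set} → Graph V → ℕ → Set
EdgeColourable G k = Σ (EdgeColouring G k) Proper

-- class 1: chromatic index (least k with a proper k-edge-colouring) equals Δ
Class1 : ∀ {n} → Graph (Fin n) → Set
Class1 G = EdgeColourable G (maxDegree G) × (∀ k → EdgeColourable G k → maxDegree G ≤ k)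

IsClique : ∀ {n} → Graph (Fin n) → Subset n → Set
IsClique G S = ∀ u v → u ∈ S → v ∈ S → u ≢ v → adj G u v ≡ true

IsCoclique : ∀ {n} → Graph (Fin n) → Subset n → Set
IsCoclique G S = ∀ u v → u ∈ S → v ∈ S → adj G u v ≡ false

module Submission where

open import Defs renaming (sym to adj-sym)
open import Data.Nat using (ℕ; _/_)
open import Data.Nat.Divisibility using (_∣_)
open import Data.Fin using (Fin)
open import Data.Fin.Subset using (Subset; ∁; ∣_∣)
open import Data.Product using (_×_)
open import Data.Sum using (_⊎_)
open import Relation.Binary.PropositionalEquality using (_≡_)

open import Data.Nat using (zero; suc; pred; _+_; _*_; _∸_; _≤_; _<_; _<ᵇ_; _⊔_; _%_; z≤n; s≤s; >-nonZero)
open import Data.Nat.Properties hiding (_≟_)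
open import Data.Nat.DivMod using (_mod_; %-distribˡ-+; [m+n]%n≡m%n; m<n⇒m%n≡m)
open import Algebra.Properties.Semiring.Sum +-*-semiring
  using (sum; sum-syntax; sum-cong-≗; ∑-distrib-+; ∑-comm; *-distribʳ-sum)
open import Data.Bool using (Bool; true; false; _∧_; _∨_; not; _xor_; if_then_else_)
open import Data.Bool.Properties
  using (¬-not; not-involutive; not-injective; ∧-comm; ∨-comm; ∧-identityʳ; ∧-zeroʳ; ∨-identityʳ;
         xor-comm; xor-same; T-≡)
  renaming (_≟_ to _≟ᵇ_)
open import Data.Maybe using (Maybe; just; nothing; is-just)
import Data.Maybe as Maybe
import Data.Maybe.Properties as Maybe
open import Data.Fin using (zero; suc; toℕ; _≟_; splitAt; _↑ˡ_; _↑ʳ_) renaming (_<_ to _<ᶠ_)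
import Data.Fin.Properties as Fin
open import Data.Fin.Permutation.Components using (transpose; transpose-inverse)
open import Data.Fin.Subset using (_∈_)
open import Data.Vec using ([]; _∷_; lookup; here; there)
import Data.Vec.Properties as Vec
open import Data.List using (length; filter; map; foldr; tabulate)
open import Data.Product using (Σ; _,_; proj₁; proj₂; map₂)
open import Data.Sum using (inj₁; inj₂; [_,_]′)
open import Data.Empty using (⊥; ⊥-elim)
open import Function using (_∘_; case_of_)
open import Function.Bundles using (Equivalence)
open import Relation.Nullary using (¬_; Dec; yes; no; does)
open import Relation.Nullary.Decidable using (dec-true; dec-false)
open import Relation.Binary using (tri<; tri≈; tri>)
open import Relation.Binary.PropositionalEquality
  using (_≢_; refl; sym; trans; cong; cong₂; subst; subst₂; module ≡-Reasoning)

-- Write V₂ = ∁ V₁, let d be the degree of G, and call the edges between V₁ and V₂ cross edges.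
-- Counting the cross edges from both sides, |V₁| = |V₂| pins down the cross degrees.
-- (i) If the halves are 1-factorable they are k₁- and k₂-regular, so the cross degrees are d − k₁
-- and d − k₂; double counting forces k₁ = k₂ = k. The cross graph is then a (d − k)-regular
-- bipartite graph, which by König's theorem is the union of d − k perfect matchings; together
-- with the k 1-factors of the halves they 1-factorise G.
-- (ii) If V₁ is a coclique, double counting shows that V₂ is one too, so G is bipartite and König's
-- theorem gives d colours. If V₁ is a clique of size m + 1, all cross degrees equal c = d − m, and
-- c ≥ 1 by connectivity. One colour class of a König colouring of the cross graph is a perfect
-- matching M. Label V₁ by 0, …, m and each vertex of V₂ by the label of its M-partner; colouring
-- every edge uv inside V₁, inside V₂ or in M by label u + label v mod (m + 1) is proper, and the
-- other c − 1 cross colours complete a colouring with d colours.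

∧-true : ∀ {a b} → a ∧ b ≡ true → a ≡ true × b ≡ true
∧-true {true} {true} _ = refl , refl

∨-true : ∀ {a b} → a ∨ b ≡ true → a ≡ true ⊎ b ≡ true
∨-true {true}  _   = inj₁ refl
∨-true {false} a∨b = inj₂ a∨b

both-sides : ∀ {n} (S : Fin n → Bool) {P : Fin n → Set} →
  (∀ u → S u ≡ true → P u) → (∀ u → S u ≡ false → P u) → ∀ u → P u
both-sides S in-S out-S u with S u ≟ᵇ true
... | yes Su = in-S u Su
... | no ¬Su = out-S u (¬-not ¬Su)

iverson : Bool → ℕ
iverson true  = 1
iverson false = 0

count : ∀ {n} → (Fin n → Bool) → ℕ
count {n} P = ∑[ i < n ] iverson (P i)

∑-mono-≤ : ∀ {n} {f g : Fin n → ℕ} → (∀ i → f i ≤ g i) → sum f ≤ sum g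
∑-mono-≤ {zero}  f≤g = z≤n
∑-mono-≤ {suc n} f≤g = +-mono-≤ (f≤g zero) (∑-mono-≤ (f≤g ∘ suc))

∑-mono-< : ∀ {n} {f g : Fin n → ℕ} → (∀ i → f i ≤ g i) → ∀ j → f j < g j → sum f < sum g
∑-mono-< f≤g zero    fj<gj = +-mono-<-≤ fj<gj (∑-mono-≤ (f≤g ∘ suc))
∑-mono-< f≤g (suc j) fj<gj = +-mono-≤-< (f≤g zero) (∑-mono-< (f≤g ∘ suc) j fj<gj)

∑-mono-≤-tight : ∀ {n} {f g : Fin n → ℕ} → (∀ i → f i ≤ g i) → sum g ≤ sum f → ∀ i → f i ≡ g i
∑-mono-≤-tight f≤g ∑g≤∑f i =
  ≤-antisym (f≤g i) (≮⇒≥ λ fi<gi → <⇒≱ (∑-mono-< f≤g i fi<gi) ∑g≤∑f)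

_==_ : ∀ {n} → Fin n → Fin n → Bool
i == j = does (i ≟ j)

==-refl : ∀ {n} (i : Fin n) → i == i ≡ true
==-refl i = dec-true (i ≟ i) refl

≢⇒==-false : ∀ {n} {i j : Fin n} → i ≢ j → i == j ≡ false
≢⇒==-false {i = i} {j} = dec-false (i ≟ j)

==⇒≡ : ∀ {n} {i j : Fin n} → i == j ≡ true → i ≡ j
==⇒≡ {i = i} {j} eq with i ≟ j
... | yes i≡j = i≡j
==⇒≡ () | no _

_─_ : ∀ {n} → (Fin n → Bool) → Fin n → Fin n → Bool
(P ─ j) i = P i ∧ not (i == j)

─-true : ∀ {n} (P : Fin n → Bool) {i j} → P i ≡ true → i ≢ j → (P ─ j) i ≡ true
─-true P Pi i≢j rewrite Pi | ≢⇒==-false i≢j = refl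

count-cong : ∀ {n} {P Q : Fin n → Bool} → (∀ i → P i ≡ Q i) → count P ≡ count Q
count-cong P≗Q = sum-cong-≗ (cong iverson ∘ P≗Q)

count-false : ∀ {n} → count {n} (λ _ → false) ≡ 0
count-false {zero}  = refl
count-false {suc n} = count-false {n}

count-true : ∀ {n} → count {n} (λ _ → true) ≡ n
count-true {zero}  = refl
count-true {suc n} = cong suc (count-true {n})

count-singleton : ∀ {n} (j : Fin n) → count (_== j) ≡ 1
count-singleton {suc n} zero = cong suc (count-false {n})
count-singleton {suc n} (suc j) = count-singleton j

count-split : ∀ {n} (P S : Fin n → Bool) →
  count P ≡ count (λ i → P i ∧ S i) + count (λ i → P i ∧ not (S i))
count-split P S = trans (sum-cong-≗ split)
  (∑-distrib-+ (λ i → iverson (P i ∧ S i)) (λ i → iverson (P i ∧ not (S i))))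
  where
  split : ∀ i → iverson (P i) ≡ iverson (P i ∧ S i) + iverson (P i ∧ not (S i))
  split i with P i | S i
  ... | true  | true  = refl
  ... | true  | false = refl
  ... | false | _     = refl

count-remove : ∀ {n} (P : Fin n → Bool) (j : Fin n) → P j ≡ true → count P ≡ suc (count (P ─ j))
count-remove P j Pj = begin
  count P                                    ≡⟨ count-split P (_== j) ⟩
  count (λ i → P i ∧ i == j) + count (P ─ j) ≡⟨ cong (_+ count (P ─ j)) (count-cong only-j) ⟩
  count (_== j) + count (P ─ j)              ≡⟨ cong (_+ count (P ─ j)) (count-singleton j) ⟩
  suc (count (P ─ j))                        ∎
  where
  open ≡-Reasoning
  only-j : ∀ i → (P i ∧ i == j) ≡ (i == j)
  only-j i with i ≟ j
  ... | yes refl rewrite Pj = refl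
  ... | no _ with P i
  ...   | true  = refl
  ...   | false = refl

count-≤-injection : ∀ {m n} (P : Fin m → Bool) (Q : Fin n → Bool) (f : ∀ i → P i ≡ true → Fin n) →
  (∀ i Pi → Q (f i Pi) ≡ true) →
  (∀ i j Pi Pj → f i Pi ≡ f j Pj → i ≡ j) → count P ≤ count Q
count-≤-injection {zero}  P Q f PQ inj = z≤n
count-≤-injection {suc m} P Q f PQ inj with P zero in P0
... | false = count-≤-injection (P ∘ suc) Q (f ∘ suc) (PQ ∘ suc)
                (λ i j Pi Pj fi≡fj → Fin.suc-injective (inj _ _ Pi Pj fi≡fj))
... | true  = subst (suc (count (P ∘ suc)) ≤_) (sym (count-remove Q f₀ (PQ zero P0)))
                (s≤s (count-≤-injection (P ∘ suc) (Q ─ f₀) (f ∘ suc)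
                  (λ i Pi → ─-true Q (PQ (suc i) Pi) (λ fi≡f₀ → case inj (suc i) zero Pi P0 fi≡f₀ of λ ()))
                  (λ i j Pi Pj fi≡fj → Fin.suc-injective (inj _ _ Pi Pj fi≡fj))))
  where f₀ = f zero P0

count-mono : ∀ {n} (P Q : Fin n → Bool) → (∀ i → P i ≡ true → Q i ≡ true) → count P ≤ count Q
count-mono P Q P⊆Q = count-≤-injection P Q (λ i _ → i) P⊆Q (λ _ _ _ _ i≡j → i≡j)

count≤n : ∀ {n} (P : Fin n → Bool) → count P ≤ n
count≤n {n} P = subst (count P ≤_) (count-true {n}) (count-mono P (λ _ → true) (λ _ _ → refl))

count-mono-< : ∀ {n} (P Q : Fin n → Bool) (j : Fin n) → (∀ i → P i ≡ true → Q i ≡ true) →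
  Q j ≡ true → P j ≡ false → count P < count Q
count-mono-< P Q j P⊆Q Qj Pj = subst (count P <_) (sym (count-remove Q j Qj))
  (s≤s (count-mono P (Q ─ j) λ i Pi → ─-true Q (P⊆Q i Pi) λ { refl → case trans (sym Pi) Pj of λ () }))

0<count : ∀ {n} (P : Fin n → Bool) (j : Fin n) → P j ≡ true → 0 < count P
0<count P j Pj rewrite count-remove P j Pj = s≤s z≤n

0<count⇒witness : ∀ {n} (P : Fin n → Bool) → 0 < count P → Σ (Fin n) λ i → P i ≡ true
0<count⇒witness {n} P 0<#P with Fin.any? (λ i → P i ≟ᵇ true)
... | yes witness = witness
... | no  none    = ⊥-elim (<⇒≱ 0<#P (≤-reflexive (trans (count-cong allFalse) (count-false {n}))))
  where
  allFalse : ∀ i → P i ≡ false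
  allFalse i = ¬-not (λ Pi → none (i , Pi))

_≺_ : ∀ {n} → Fin n → Fin n → Bool
w ≺ u = toℕ w <ᵇ toℕ u

≺⇒< : ∀ {n} {w u : Fin n} → w ≺ u ≡ true → w <ᶠ u
≺⇒< {w = w} {u} w≺u = <ᵇ⇒< (toℕ w) (toℕ u) (Equivalence.from T-≡ w≺u)

<⇒≺ : ∀ {n} {w u : Fin n} → w <ᶠ u → w ≺ u ≡ true
<⇒≺ w<u = Equivalence.to T-≡ (<⇒<ᵇ w<u)

≺-irrefl : ∀ {n} (w : Fin n) → w ≺ w ≡ false
≺-irrefl w = ¬-not λ w≺w → Fin.<-irrefl refl (≺⇒< {w = w} {w} w≺w)

module _ {n} (S : Fin n → Bool) where

  below : Fin n → Fin n → Bool
  below u w = S w ∧ w ≺ u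

  rank : Fin n → ℕ
  rank u = count (below u)

  rank<count : ∀ {u} → S u ≡ true → rank u < count S
  rank<count {u} Su = subst (rank u <_) (sym (count-remove S u Su))
    (s≤s (count-mono (below u) (S ─ u) λ w w-below → let (Sw , w≺u) = ∧-true w-below in
      ─-true S Sw λ w≡u → Fin.<-irrefl w≡u (≺⇒< w≺u)))

  rank-mono : ∀ {v w} → S v ≡ true → v <ᶠ w → rank v < rank w
  rank-mono {v} {w} Sv v<w = count-mono-< (below v) (below w) v
    (λ z z-below → let (Sz , z≺v) = ∧-true z-below in cong₂ _∧_ Sz (<⇒≺ (Fin.<-trans (≺⇒< z≺v) v<w)))
    (cong₂ _∧_ Sv (<⇒≺ v<w))
    (trans (cong (S v ∧_) (≺-irrefl v)) (∧-zeroʳ (S v)))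

  rank-injective : ∀ {v w} → S v ≡ true → S w ≡ true → rank v ≡ rank w → v ≡ w
  rank-injective {v} {w} Sv Sw rank≡ with Fin.<-cmp v w
  ... | tri< v<w _ _ = ⊥-elim (<-irrefl rank≡ (rank-mono Sv v<w))
  ... | tri≈ _ v≡w _ = v≡w
  ... | tri> _ _ w<v = ⊥-elim (<-irrefl (sym rank≡) (rank-mono Sw w<v))

-- Partial proper edge colourings

Relation : ℕ → Set
Relation n = Fin n → Fin n → Bool

-- Colours are defined exactly on the edges of E, so colourings of disjoint relations can be merged.
record Colouring {n} (k : ℕ) (E : Relation n) : Set where
  field
    χ        : Fin n → Fin n → Maybe (Fin k)
    χ-domain : ∀ u v → is-just (χ u v) ≡ E u v
    χ-sym    : ∀ u v → χ u v ≡ χ v u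
    χ-proper : ∀ u v w i → χ u v ≡ just i → χ u w ≡ just i → v ≡ w
open Colouring public

module _ {n k} {E : Relation n} (C : Colouring k E) where

  Saturated : Fin n → Set
  Saturated u = ∀ i → Σ (Fin n) λ v → χ C u v ≡ just i

  Missing : Fin n → Fin k → Set
  Missing u i = ∀ v → χ C u v ≢ just i

  χ⇒edge : ∀ {u v i} → χ C u v ≡ just i → E u v ≡ true
  χ⇒edge {u} {v} χuv = trans (sym (χ-domain C u v)) (cong is-just χuv)

  non-edge⇒χ : ∀ {u v} → E u v ≡ false → χ C u v ≡ nothing
  non-edge⇒χ {u} {v} ¬Euv with χ C u v in χuv
  ... | nothing = refl
  ... | just i  = case trans (sym (χ⇒edge χuv)) ¬Euv of λ ()

  edge⇒χ : ∀ {u v} → E u v ≡ true → Σ (Fin k) λ i → χ C u v ≡ just i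
  edge⇒χ {u} {v} Euv with χ C u v in χuv
  ... | just i  = i , refl
  ... | nothing = case trans (sym (cong is-just χuv)) (trans (χ-domain C u v) Euv) of λ ()

  colouring-sym : ∀ u v → E u v ≡ E v u
  colouring-sym u v = trans (sym (χ-domain C u v)) (trans (cong is-just (χ-sym C u v)) (χ-domain C v u))

  colour-injective : ∀ {u v w} (Euv : E u v ≡ true) (Euw : E u w ≡ true) →
                     proj₁ (edge⇒χ Euv) ≡ proj₁ (edge⇒χ Euw) → v ≡ w
  colour-injective {u} {v} {w} Euv Euw same = χ-proper C u v w _ (proj₂ (edge⇒χ Euv))
    (subst (λ i → χ C u w ≡ just i) (sym same) (proj₂ (edge⇒χ Euw)))

  degree≤colours : ∀ u → count (E u) ≤ k
  degree≤colours u = subst (count (E u) ≤_) (count-true {k})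
    (count-≤-injection (E u) (λ _ → true) (λ v Euv → proj₁ (edge⇒χ Euv)) (λ _ _ → refl)
      λ v w → colour-injective)

  saturated⇒colours≤degree : ∀ u → Saturated u → k ≤ count (E u)
  saturated⇒colours≤degree u sat = subst (_≤ count (E u)) (count-true {k})
    (count-≤-injection (λ _ → true) (E u) (λ i _ → proj₁ (sat i)) (λ i _ → χ⇒edge (proj₂ (sat i)))
      λ i j _ _ vi≡vj → Maybe.just-injective
        (trans (sym (proj₂ (sat i))) (trans (cong (χ C u) vi≡vj) (proj₂ (sat j)))))

  saturated⇒degree≡ : ∀ u → Saturated u → count (E u) ≡ k
  saturated⇒degree≡ u sat = ≤-antisym (degree≤colours u) (saturated⇒colours≤degree u sat)

  missing⇒degree< : ∀ u i → Missing u i → count (E u) < k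
  missing⇒degree< u i miss = subst (count (E u) <_) (trans (sym (count-remove _ i refl)) (count-true {k}))
    (s≤s (count-≤-injection (E u) ((λ _ → true) ─ i) (λ v Euv → proj₁ (edge⇒χ Euv))
      (λ v Euv → ─-true (λ _ → true) refl λ χuv≡i →
                   miss v (subst (λ j → χ C u v ≡ just j) χuv≡i (proj₂ (edge⇒χ Euv))))
      λ v w → colour-injective))

  appears? : ∀ u i → Dec (Σ (Fin n) λ v → χ C u v ≡ just i)
  appears? u i = Fin.any? λ v → Maybe.≡-dec Fin._≟_ (χ C u v) (just i)

  degree≡⇒saturated : ∀ u → count (E u) ≡ k → Saturated u
  degree≡⇒saturated u deg≡k i with appears? u i
  ... | yes appears = appears
  ... | no  missing = ⊥-elim (<-irrefl deg≡k (missing⇒degree< u i λ v χuv≡i → missing (v , χuv≡i)))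

  degree<⇒missing : ∀ u → count (E u) < k → Σ (Fin k) (Missing u)
  degree<⇒missing u deg<k with Fin.all? (appears? u)
  ... | yes sat = ⊥-elim (<⇒≱ deg<k (saturated⇒colours≤degree u sat))
  ... | no ¬sat with Fin.¬∀⟶∃¬ k _ (appears? u) ¬sat
  ...   | i , ¬appears = i , λ v χuv≡i → ¬appears (v , χuv≡i)

colouring-cong : ∀ {n k} {E F : Relation n} → (∀ u v → E u v ≡ F u v) → Colouring k E → Colouring k F
colouring-cong E≗F C = record
  { χ = χ C ; χ-domain = λ u v → trans (χ-domain C u v) (E≗F u v) ; χ-sym = χ-sym C ; χ-proper = χ-proper C }

empty-colouring : ∀ {n k} {E : Relation n} → (∀ u v → E u v ≡ false) → Colouring k E
empty-colouring noEdges = record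
  { χ = λ _ _ → nothing ; χ-domain = λ u v → sym (noEdges u v) ; χ-sym = λ _ _ → refl ; χ-proper = λ _ _ _ _ () }

↑ˡ≢↑ʳ : ∀ {k k′} (i : Fin k) (j : Fin k′) → i ↑ˡ k′ ≢ k ↑ʳ j
↑ˡ≢↑ʳ zero    j ()
↑ˡ≢↑ʳ (suc i) j eq = ↑ˡ≢↑ʳ i j (Fin.suc-injective eq)

module _ {k k′ : ℕ} where

  _⊕_ : Maybe (Fin k) → Maybe (Fin k′) → Maybe (Fin (k + k′))
  just i  ⊕ _ = just (i ↑ˡ k′)
  nothing ⊕ b = Maybe.map (k ↑ʳ_) b

  ⊕-is-just : ∀ a b → is-just (a ⊕ b) ≡ is-just a ∨ is-just b
  ⊕-is-just (just _) b        = refl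
  ⊕-is-just nothing (just _) = refl
  ⊕-is-just nothing nothing  = refl

  ⊕-cancel : ∀ a b a′ b′ {i} → a ⊕ b ≡ just i → a′ ⊕ b′ ≡ just i →
             (Σ (Fin k) λ j → a ≡ just j × a′ ≡ just j) ⊎ (Σ (Fin k′) λ j → b ≡ just j × b′ ≡ just j)
  ⊕-cancel (just j) _        (just j′) _         refl eq =
    inj₁ (j , refl , cong just (Fin.↑ˡ-injective k′ j′ j (Maybe.just-injective eq)))
  ⊕-cancel nothing  (just j) nothing   (just j′) refl eq =
    inj₂ (j , refl , cong just (Fin.↑ʳ-injective k j′ j (Maybe.just-injective eq)))
  ⊕-cancel (just j) _        nothing   (just j′) refl eq = ⊥-elim (↑ˡ≢↑ʳ j j′ (sym (Maybe.just-injective eq)))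
  ⊕-cancel nothing  (just j) (just j′) _         refl eq = ⊥-elim (↑ˡ≢↑ʳ j′ j (Maybe.just-injective eq))
  ⊕-cancel (just _) _        nothing   nothing   refl ()
  ⊕-cancel nothing  (just _) nothing   nothing   refl ()
  ⊕-cancel nothing  nothing  _         _         ()

merge : ∀ {n k k′} {A B : Relation n} → Colouring k A → Colouring k′ B →
        Colouring (k + k′) (λ u v → A u v ∨ B u v)
merge CA CB = record
  { χ        = λ u v → χ CA u v ⊕ χ CB u v
  ; χ-domain = λ u v → trans (⊕-is-just (χ CA u v) (χ CB u v)) (cong₂ _∨_ (χ-domain CA u v) (χ-domain CB u v))
  ; χ-sym    = λ u v → cong₂ _⊕_ (χ-sym CA u v) (χ-sym CB u v)
  ; χ-proper = λ u v w i χuv χuw → case ⊕-cancel _ _ _ _ χuv χuw of λ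
      { (inj₁ (j , χAuv , χAuw)) → χ-proper CA u v w j χAuv χAuw
      ; (inj₂ (j , χBuv , χBuw)) → χ-proper CB u v w j χBuv χBuw }
  }

merge-saturated : ∀ {n k k′} {A B : Relation n} (CA : Colouring k A) (CB : Colouring k′ B) →
  (∀ u v → B u v ≡ true → A u v ≡ false) →
  ∀ u → Saturated CA u → Saturated CB u → Saturated (merge CA CB) u
merge-saturated {k = k} {k′} CA CB disjoint u satA satB i with splitAt k i in split
... | inj₁ j = let (v , χAuv) = satA j in
    v , trans (cong (_⊕ χ CB u v) χAuv) (cong just (Fin.splitAt⁻¹-↑ˡ split))
... | inj₂ j = let (v , χBuv) = satB j in
    v , trans (cong₂ _⊕_ (non-edge⇒χ CA (disjoint u v (χ⇒edge CB χBuv))) χBuv)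
              (cong just (Fin.splitAt⁻¹-↑ʳ split))

module _ {n k} (S : Fin n → Bool) {A B : Relation n} (CA : Colouring k A) (CB : Colouring k B)
         (A⊆S : ∀ u v → A u v ≡ true → S u ≡ true) (B⊆∁S : ∀ u v → B u v ≡ true → S u ≡ false) where

  private
    A-off : ∀ {u} v → S u ≡ false → A u v ≡ false
    A-off {u} v ¬Su with A u v in Auv
    ... | false = refl
    ... | true  = case trans (sym (A⊆S u v Auv)) ¬Su of λ ()

    B-off : ∀ {u} v → S u ≡ true → B u v ≡ false
    B-off {u} v Su with B u v in Buv
    ... | false = refl
    ... | true  = case trans (sym Su) (B⊆∁S u v Buv) of λ ()

    χ∪ : Fin n → Fin n → Maybe (Fin k)
    χ∪ u v = if S u then χ CA u v else χ CB u v

    χ∪-domain : ∀ u v → is-just (χ∪ u v) ≡ A u v ∨ B u v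
    χ∪-domain u v with S u in Su
    ... | true  = trans (χ-domain CA u v) (trans (sym (∨-identityʳ (A u v))) (cong (A u v ∨_) (sym (B-off v Su))))
    ... | false = trans (χ-domain CB u v) (cong (_∨ B u v) (sym (A-off v Su)))

    χ∪-sym : ∀ u v → χ∪ u v ≡ χ∪ v u
    χ∪-sym u v with S u in Su | S v in Sv
    ... | true  | true  = χ-sym CA u v
    ... | false | false = χ-sym CB u v
    ... | true  | false = trans (non-edge⇒χ CA (trans (colouring-sym CA u v) (A-off u Sv)))
                                (sym (non-edge⇒χ CB (trans (colouring-sym CB v u) (B-off v Su))))
    ... | false | true  = trans (non-edge⇒χ CB (trans (colouring-sym CB u v) (B-off u Sv)))
                                (sym (non-edge⇒χ CA (trans (colouring-sym CA v u) (A-off v Su))))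

    χ∪-proper : ∀ u v w i → χ∪ u v ≡ just i → χ∪ u w ≡ just i → v ≡ w
    χ∪-proper u v w i with S u
    ... | true  = χ-proper CA u v w i
    ... | false = χ-proper CB u v w i

  side-union : Colouring k (λ u v → A u v ∨ B u v)
  side-union = record { χ = χ∪ ; χ-domain = χ∪-domain ; χ-sym = χ∪-sym ; χ-proper = χ∪-proper }

  side-union-saturated : (∀ u → S u ≡ true → Saturated CA u) → (∀ u → S u ≡ false → Saturated CB u) →
    ∀ u → Saturated side-union u
  side-union-saturated satA satB u with S u in Su
  ... | true  = satA u Su
  ... | false = satB u Su

shift-down : ∀ {k} → Maybe (Fin (suc k)) → Maybe (Fin k)
shift-down (just (suc i)) = just i
shift-down _              = nothing

shift-down-just : ∀ {k} (m : Maybe (Fin (suc k))) {i} → shift-down m ≡ just i → m ≡ just (suc i)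
shift-down-just (just (suc _)) refl = refl

drop-colour-zero : ∀ {n k} {E : Relation n} (C : Colouring (suc k) E) →
  Colouring k (λ u v → is-just (shift-down (χ C u v)))
drop-colour-zero C = record
  { χ        = λ u v → shift-down (χ C u v)
  ; χ-domain = λ _ _ → refl
  ; χ-sym    = λ u v → cong shift-down (χ-sym C u v)
  ; χ-proper = λ u v w i χuv χuw → χ-proper C u v w (suc i) (shift-down-just _ χuv) (shift-down-just _ χuw) }

-- König's edge-colouring theorem

module Closure {n} (step : Relation n) (y : Fin n) where

  reach : ℕ → Fin n → Bool
  reach zero    u = u == y
  reach (suc t) u = reach t u ∨ does (Fin.any? λ w → (reach t w ∧ step w u) ≟ᵇ true)

  reach-step : ∀ t {u v} → reach t u ≡ true → step u v ≡ true → reach (suc t) v ≡ true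
  reach-step t {u} {v} ρu uv with reach t v
  ... | true  = refl
  ... | false = dec-true (Fin.any? _) (u , cong₂ _∧_ ρu uv)

  reach-suc : ∀ t {v} → reach (suc t) v ≡ true →
              reach t v ≡ true ⊎ Σ (Fin n) λ u → reach t u ≡ true × step u v ≡ true
  reach-suc t {v} ρv with reach t v | Fin.any? (λ w → (reach t w ∧ step w v) ≟ᵇ true)
  ... | true  | _               = inj₁ refl
  ... | false | yes (u , ρu∧uv) = inj₂ (u , ∧-true ρu∧uv)
  reach-suc t () | false | no _

  reach-mono : ∀ j t {u} → reach t u ≡ true → reach (j + t) u ≡ true
  reach-mono zero    t ρu = ρu
  reach-mono (suc j) t {u} ρu with reach (j + t) u in ρ′u
  ... | true  = refl
  ... | false = case trans (sym (reach-mono j t ρu)) ρ′u of λ ()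

  Stable : ℕ → Set
  Stable s = ∀ u → reach (suc s) u ≡ true → reach s u ≡ true

  stable-forever : ∀ {s} → Stable s → ∀ j {u} → reach (j + s) u ≡ true → reach s u ≡ true
  stable-forever st zero    ρu = ρu
  stable-forever {s} st (suc j) {u} ρu with reach-suc (j + s) ρu
  ... | inj₁ ρu′              = stable-forever st j ρu′
  ... | inj₂ (w , ρw , wu)    = st u (reach-step s (stable-forever st j ρw) wu)

  -- Until reach stabilises it gains a vertex at every step, so it stabilises within n steps.
  stabilises : ∀ t → (Σ ℕ λ s → s ≤ t × Stable s) ⊎ t < count (reach t)
  stabilises zero = inj₂ (0<count (reach zero) y (==-refl y))
  stabilises (suc t) with stabilises t
  ... | inj₁ (s , s≤t , st) = inj₁ (s , m≤n⇒m≤1+n s≤t , st)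
  ... | inj₂ t<#reach with Fin.any? (λ u → (reach (suc t) u ∧ not (reach t u)) ≟ᵇ true)
  ...   | no  none = inj₁ (t , n≤1+n t , λ u ρu → ¬-not λ ¬ρu → none (u , cong₂ _∧_ ρu (cong not ¬ρu)))
  ...   | yes (u , new) = let (ρ′u , ¬ρu) = ∧-true new in
      inj₂ (≤-trans (s≤s t<#reach) (count-mono-< (reach t) (reach (suc t)) u (λ _ → reach-mono 1 t) ρ′u
                                      (trans (sym (not-involutive _)) (cong not ¬ρu))))

  closure : Fin n → Bool
  closure = reach n

  closure-start : closure y ≡ true
  closure-start = subst (λ t → reach t y ≡ true) (+-identityʳ n) (reach-mono n zero (==-refl y))

  closure-closed : ∀ {u v} → closure u ≡ true → step u v ≡ true → closure v ≡ true
  closure-closed {u} {v} ρu uv with stabilises n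
  ... | inj₂ n<#reach = ⊥-elim (<⇒≱ n<#reach (count≤n (reach n)))
  ... | inj₁ (s , s≤n , st) = subst (λ t → reach t v ≡ true) n∸s+s≡n
          (reach-mono (n ∸ s) s (stable-forever st (suc (n ∸ s))
            (subst (λ t → reach t v ≡ true) (sym (cong suc n∸s+s≡n)) (reach-step n ρu uv))))
    where n∸s+s≡n = m∸n+n≡m s≤n

  closure-least : (P : Fin n → Set) → P y → (∀ {u v} → P u → step u v ≡ true → P v) →
                  ∀ {u} → closure u ≡ true → P u
  closure-least P Py P-closed = reach-least n
    where
    reach-least : ∀ t {u} → reach t u ≡ true → P u
    reach-least zero    ρu = subst P (sym (==⇒≡ ρu)) Py
    reach-least (suc t) ρu with reach-suc t ρu
    ... | inj₁ ρu′           = reach-least t ρu′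
    ... | inj₂ (w , ρw , wu) = P-closed (reach-least t ρw) wu

module Kempe {n k} {E : Relation n} (side : Fin n → Bool)
  (bipartite : ∀ u v → E u v ≡ true → side u ≢ side v)
  (C : Colouring k E) {x y : Fin n} (x∦y : side x ≢ side y) {α β : Fin k}
  (α∉x : Missing C x α) (β∉y : Missing C y β) where

  αβ : Maybe (Fin k) → Bool
  αβ (just i) = i == α ∨ i == β
  αβ nothing  = false

  αβ-true : ∀ {m} → αβ m ≡ true → m ≡ just α ⊎ m ≡ just β
  αβ-true {just i} i∈αβ with ∨-true i∈αβ
  ... | inj₁ i≡α = inj₁ (cong just (==⇒≡ i≡α))
  ... | inj₂ i≡β = inj₂ (cong just (==⇒≡ i≡β))

  open Closure (λ u v → αβ (χ C u v)) y using ()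
    renaming (closure to chain; closure-start to y∈chain; closure-closed to chain-closed; closure-least to chain-least)

  opposite : ∀ {u v i} → χ C u v ≡ just i → side u ≢ side v
  opposite χuv = bipartite _ _ (χ⇒edge C χuv)

  same-side : ∀ {a b c : Bool} → a ≢ c → b ≢ c → a ≡ b
  same-side a≢c b≢c = trans (¬-not a≢c) (sym (¬-not b≢c))

  -- The α/β-chain from y leaves the side of y along α-edges and the other side along β-edges;
  -- as x lies on the other side and misses α, the chain never reaches x.
  data Alternating : Fin n → Set where
    start  : Alternating y
    α-step : ∀ {w u} → Alternating w → side w ≡ side y → χ C w u ≡ just α → Alternating u
    β-step : ∀ {w u} → Alternating w → side w ≢ side y → χ C w u ≡ just β → Alternating u

  back-along-β : ∀ {u v} → Alternating u → side u ≡ side y → χ C u v ≡ just β → Alternating v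
  back-along-β start                       _  χyv≡β = ⊥-elim (β∉y _ χyv≡β)
  back-along-β (α-step {w} _  sw χwu≡α)    su _     = ⊥-elim (opposite χwu≡α (trans sw (sym su)))
  back-along-β (β-step {w} aw _  χwu≡β)    _  χuv≡β =
    subst Alternating (χ-proper C _ w _ β (trans (χ-sym C _ w) χwu≡β) χuv≡β) aw

  back-along-α : ∀ {u v} → Alternating u → side u ≢ side y → χ C u v ≡ just α → Alternating v
  back-along-α start                       ¬sy _     = ⊥-elim (¬sy refl)
  back-along-α (α-step {w} aw _  χwu≡α)    _   χuv≡α =
    subst Alternating (χ-proper C _ w _ α (trans (χ-sym C _ w) χwu≡α) χuv≡α) aw
  back-along-α (β-step {w} _  ¬sw χwu≡β)   ¬su _     = ⊥-elim (opposite χwu≡β (same-side ¬sw ¬su))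

  alternating-closed : ∀ {u v} → Alternating u → αβ (χ C u v) ≡ true → Alternating v
  alternating-closed {u} au uv with side u ≟ᵇ side y | αβ-true uv
  ... | yes su  | inj₁ χuv≡α = α-step au su χuv≡α
  ... | no  ¬su | inj₂ χuv≡β = β-step au ¬su χuv≡β
  ... | yes su  | inj₂ χuv≡β = back-along-β au su χuv≡β
  ... | no  ¬su | inj₁ χuv≡α = back-along-α au ¬su χuv≡α

  not-alternating : ∀ {u} → side u ≢ side y → Missing C u α → ¬ Alternating u
  not-alternating ¬su _   start                    = ¬su refl
  not-alternating _   α∉u (α-step {w} _ _ χwu≡α)   = α∉u w (trans (χ-sym C _ w) χwu≡α)
  not-alternating ¬su _   (β-step {w} _ ¬sw χwu≡β) = opposite χwu≡β (same-side ¬sw ¬su)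

  x∉chain : chain x ≡ false
  x∉chain = ¬-not λ x∈chain → not-alternating x∦y α∉x (chain-least Alternating start alternating-closed x∈chain)

  σ : Fin k → Fin k
  σ = transpose α β

  σ-fixes : ∀ m → αβ m ≡ false → Maybe.map σ m ≡ m
  σ-fixes nothing  _ = refl
  σ-fixes (just i) i∉αβ with i == α | i == β in i≟β
  ... | false | false rewrite i≟β = refl
  σ-fixes (just i) () | true  | _
  σ-fixes (just i) () | false | true

  σ-is-just : ∀ m → is-just (Maybe.map σ m) ≡ is-just m
  σ-is-just (just _) = refl
  σ-is-just nothing  = refl

  σ-injective : ∀ m {i} → Maybe.map σ m ≡ just i → m ≡ just (transpose β α i)
  σ-injective (just j) refl = cong just (sym (transpose-inverse β α))

  transpose-βα-α : transpose β α α ≡ β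
  transpose-βα-α with α ≟ β
  ... | yes α≡β = α≡β
  ... | no  _   rewrite dec-true (α ≟ α) refl = refl

  χ′ : Fin n → Fin n → Maybe (Fin k)
  χ′ u v = if chain u then Maybe.map σ (χ C u v) else χ C u v

  χ′-domain : ∀ u v → is-just (χ′ u v) ≡ E u v
  χ′-domain u v with chain u
  ... | true  = trans (σ-is-just (χ C u v)) (χ-domain C u v)
  ... | false = χ-domain C u v

  -- An α/β-edge never leaves the chain, so an edge with one end in the chain keeps its colour.
  χ′-sym : ∀ u v → χ′ u v ≡ χ′ v u
  χ′-sym u v with chain u in u∈ | chain v in v∈ | αβ (χ C u v) in uv∈αβ
  ... | true  | true  | _     = cong (Maybe.map σ) (χ-sym C u v)
  ... | false | false | _     = χ-sym C u v
  ... | true  | false | false = trans (σ-fixes (χ C u v) uv∈αβ) (χ-sym C u v)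
  ... | false | true  | false = trans (χ-sym C u v) (sym (σ-fixes (χ C v u) (trans (cong αβ (χ-sym C v u)) uv∈αβ)))
  ... | true  | false | true  = case trans (sym (chain-closed u∈ uv∈αβ)) v∈ of λ ()
  ... | false | true  | true  = case trans (sym (chain-closed v∈ (trans (cong αβ (χ-sym C v u)) uv∈αβ))) u∈ of λ ()

  χ′-proper : ∀ u v w i → χ′ u v ≡ just i → χ′ u w ≡ just i → v ≡ w
  χ′-proper u v w i with chain u
  ... | true  = λ χ′uv χ′uw → χ-proper C u v w _ (σ-injective _ χ′uv) (σ-injective _ χ′uw)
  ... | false = χ-proper C u v w i

  swapped : Colouring k E
  swapped = record { χ = χ′ ; χ-domain = χ′-domain ; χ-sym = χ′-sym ; χ-proper = χ′-proper }

  α∉x′ : Missing swapped x α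
  α∉x′ v rewrite x∉chain = α∉x v

  α∉y′ : Missing swapped y α
  α∉y′ v χ′yv≡α rewrite y∈chain = β∉y v (trans (σ-injective _ χ′yv≡α) (cong just transpose-βα-α))

degree-sum : ∀ {n} → Relation n → ℕ
degree-sum {n} E = ∑[ u < n ] count (E u)

module EdgeDeletion {n} (E : Relation n) (E-sym : ∀ u v → E u v ≡ E v u)
  {x y : Fin n} (x≢y : x ≢ y) (Exy : E x y ≡ true) where

  is-xy : Relation n
  is-xy u v = (u == x ∧ v == y) ∨ (u == y ∧ v == x)

  is-xy-sym : ∀ u v → is-xy u v ≡ is-xy v u
  is-xy-sym u v = trans (∨-comm (u == x ∧ v == y) _) (cong₂ _∨_ (∧-comm (u == y) _) (∧-comm (u == x) _))

  is-xy-true : ∀ u v → is-xy u v ≡ true → (u ≡ x × v ≡ y) ⊎ (u ≡ y × v ≡ x)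
  is-xy-true u v uv≡xy with ∨-true uv≡xy
  ... | inj₁ xy = let (u≡x , v≡y) = ∧-true xy in inj₁ (==⇒≡ u≡x , ==⇒≡ v≡y)
  ... | inj₂ yx = let (u≡y , v≡x) = ∧-true yx in inj₂ (==⇒≡ u≡y , ==⇒≡ v≡x)

  E⁻ : Relation n
  E⁻ u v = E u v ∧ not (is-xy u v)

  E⁻-sym : ∀ u v → E⁻ u v ≡ E⁻ v u
  E⁻-sym u v = cong₂ (λ e d → e ∧ not d) (E-sym u v) (is-xy-sym u v)

  E⁻⊆E : ∀ u v → E⁻ u v ≡ true → E u v ≡ true
  E⁻⊆E u v = proj₁ ∘ ∧-true

  E⁻xy : E⁻ x y ≡ false
  E⁻xy rewrite ==-refl x | ==-refl y = ∧-zeroʳ (E x y)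

  degree-sum-decreases : degree-sum E⁻ < degree-sum E
  degree-sum-decreases = ∑-mono-< (λ u → count-mono (E⁻ u) (E u) (E⁻⊆E u)) x
    (count-mono-< (E⁻ x) (E x) y (E⁻⊆E x) Exy E⁻xy)

  module _ {k} (C : Colouring k E⁻) {α : Fin k} (α∉x : Missing C x α) (α∉y : Missing C y α) where

    χ⁺ : Fin n → Fin n → Maybe (Fin k)
    χ⁺ u v = if is-xy u v then just α else χ C u v

    χ⁺-domain : ∀ u v → is-just (χ⁺ u v) ≡ E u v
    χ⁺-domain u v with is-xy u v in uv≡xy
    ... | false = trans (χ-domain C u v) (trans (cong (λ d → E u v ∧ not d) uv≡xy) (∧-identityʳ (E u v)))
    ... | true with is-xy-true u v uv≡xy
    ...   | inj₁ (refl , refl) = sym Exy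
    ...   | inj₂ (refl , refl) = sym (trans (E-sym y x) Exy)

    χ⁺-sym : ∀ u v → χ⁺ u v ≡ χ⁺ v u
    χ⁺-sym u v rewrite is-xy-sym u v with is-xy v u
    ... | true  = refl
    ... | false = χ-sym C u v

    χ⁺-proper : ∀ u v w i → χ⁺ u v ≡ just i → χ⁺ u w ≡ just i → v ≡ w
    χ⁺-proper u v w i χuv χuw with is-xy u v in uv≡xy | is-xy u w in uw≡xy
    ... | false | false = χ-proper C u v w i χuv χuw
    ... | true  | false with is-xy-true u v uv≡xy
    ...   | inj₁ (refl , _) = ⊥-elim (α∉x w (trans χuw (sym χuv)))
    ...   | inj₂ (refl , _) = ⊥-elim (α∉y w (trans χuw (sym χuv)))
    χ⁺-proper u v w i χuv χuw | false | true with is-xy-true u w uw≡xy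
    ...   | inj₁ (refl , _) = ⊥-elim (α∉x v (trans χuv (sym χuw)))
    ...   | inj₂ (refl , _) = ⊥-elim (α∉y v (trans χuv (sym χuw)))
    χ⁺-proper u v w i χuv χuw | true | true with is-xy-true u v uv≡xy | is-xy-true u w uw≡xy
    ...   | inj₁ (_ , refl) | inj₁ (_ , refl) = refl
    ...   | inj₂ (_ , refl) | inj₂ (_ , refl) = refl
    ...   | inj₁ (u≡x , _)  | inj₂ (u≡y , _)  = ⊥-elim (x≢y (trans (sym u≡x) u≡y))
    ...   | inj₂ (u≡y , _)  | inj₁ (u≡x , _)  = ⊥-elim (x≢y (trans (sym u≡x) u≡y))

    add-edge : Colouring k E
    add-edge = record { χ = χ⁺ ; χ-domain = χ⁺-domain ; χ-sym = χ⁺-sym ; χ-proper = χ⁺-proper }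

-- Delete an edge xy and colour the rest; x misses some α and y some β, and swapping α and β
-- on the α/β-chain from y makes α missing at both, so xy can be coloured α.
konig-≤ : ∀ {n} k (side : Fin n → Bool) t (E : Relation n) → (∀ u v → E u v ≡ E v u) →
  (∀ u v → E u v ≡ true → side u ≢ side v) → (∀ u → count (E u) ≤ k) → degree-sum E ≤ t → Colouring k E
konig-≤ k side t E E-sym bipartite Δ≤k size≤t with Fin.any? (λ u → Fin.any? λ v → E u v ≟ᵇ true)
... | no noEdge = empty-colouring λ u v → ¬-not λ Euv → noEdge (u , v , Euv)
konig-≤ k side zero E E-sym bipartite Δ≤k size≤0 | yes (x , y , Exy) =
  ⊥-elim (n≮0 (<-≤-trans degree-sum-decreases size≤0))
  where open EdgeDeletion E E-sym (λ x≡y → bipartite x y Exy (cong side x≡y)) Exy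
konig-≤ k side (suc t) E E-sym bipartite Δ≤k size≤1+t | yes (x , y , Exy) =
  add-edge swapped α∉x′ α∉y′
  where
  x∦y : side x ≢ side y
  x∦y = bipartite x y Exy
  open EdgeDeletion E E-sym (λ x≡y → x∦y (cong side x≡y)) Exy
  bipartite⁻ : ∀ u v → E⁻ u v ≡ true → side u ≢ side v
  bipartite⁻ u v = bipartite u v ∘ E⁻⊆E u v
  C⁻ : Colouring k E⁻
  C⁻ = konig-≤ k side t E⁻ E⁻-sym bipartite⁻
         (λ u → ≤-trans (count-mono (E⁻ u) (E u) (E⁻⊆E u)) (Δ≤k u))
         (≤-pred (<-≤-trans degree-sum-decreases size≤1+t))
  x-free : Σ (Fin k) (Missing C⁻ x)
  x-free = degree<⇒missing C⁻ x (<-≤-trans (count-mono-< (E⁻ x) (E x) y (E⁻⊆E x) Exy E⁻xy) (Δ≤k x))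
  y-free : Σ (Fin k) (Missing C⁻ y)
  y-free = degree<⇒missing C⁻ y (<-≤-trans (count-mono-< (E⁻ y) (E y) x (E⁻⊆E y)
                                    (trans (E-sym y x) Exy) (trans (E⁻-sym y x) E⁻xy)) (Δ≤k y))
  open Kempe side bipartite⁻ C⁻ x∦y (proj₂ x-free) (proj₂ y-free)

konig : ∀ {n} k (side : Fin n → Bool) (E : Relation n) → (∀ u v → E u v ≡ E v u) →
  (∀ u v → E u v ≡ true → side u ≢ side v) → (∀ u → count (E u) ≤ k) → Colouring k E
konig k side E E-sym bipartite Δ≤k = konig-≤ k side (degree-sum E) E E-sym bipartite Δ≤k ≤-refl

length-filter-tabulate : ∀ {n} {A : Set} (Q : A → Bool) (g : Fin n → A) →
  length (filter (λ a → Q a ≟ᵇ true) (tabulate g)) ≡ count (Q ∘ g)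
length-filter-tabulate {zero}  Q g = refl
length-filter-tabulate {suc n} Q g with Q (g zero)
... | true  = cong suc (length-filter-tabulate Q (g ∘ suc))
... | false = length-filter-tabulate Q (g ∘ suc)

degree≡count : ∀ {n} (G : Graph (Fin n)) v → degree G v ≡ count (adj G v)
degree≡count G v = length-filter-tabulate (adj G v) (λ u → u)

⊔-tabulate-≤ : ∀ {n} {A : Set} (f : A → ℕ) (g : Fin n → A) {d} →
  (∀ i → f (g i) ≤ d) → foldr _⊔_ 0 (map f (tabulate g)) ≤ d
⊔-tabulate-≤ {zero}  f g f≤d = z≤n
⊔-tabulate-≤ {suc n} f g f≤d = ⊔-lub (f≤d zero) (⊔-tabulate-≤ f (g ∘ suc) (f≤d ∘ suc))

maxDegree≤ : ∀ {n} (G : Graph (Fin n)) {d} → (∀ v → degree G v ≤ d) → maxDegree G ≤ d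
maxDegree≤ G = ⊔-tabulate-≤ (degree G) (λ v → v)

maxDegree-regular : ∀ {n} (G : Graph (Fin (suc n))) {d} → (∀ v → degree G v ≡ d) → maxDegree G ≡ d
maxDegree-regular G {d} reg = ≤-antisym (maxDegree≤ G (≤-reflexive ∘ reg))
  (subst (_≤ maxDegree G) (reg zero) (m≤m⊔n (degree G zero) _))

proper⇒degree≤ : ∀ {n k} (G : Graph (Fin n)) (c : EdgeColouring G k) → Proper c → ∀ v → degree G v ≤ k
proper⇒degree≤ {k = k} G c proper v = subst₂ _≤_ (sym (degree≡count G v)) (count-true {k})
  (count-≤-injection (adj G v) (λ _ → true) (λ w _ → col c v w) (λ _ _ → refl) injective)
  where
  injective : ∀ u w → adj G v u ≡ true → adj G v w ≡ true → col c v u ≡ col c v w → u ≡ w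
  injective u w Evu Evw same with u ≟ w
  ... | yes u≡w = u≡w
  ... | no  u≢w = ⊥-elim (proper v u w Evu Evw u≢w same)

maxDegree≤colours : ∀ {n} (G : Graph (Fin n)) k → EdgeColourable G k → maxDegree G ≤ k
maxDegree≤colours G k (c , proper) = maxDegree≤ G (proper⇒degree≤ G c proper)

module _ {n K} (G : Graph (Fin n)) (C : Colouring K (adj G)) (default : Fin K) where

  toEdgeColouring : EdgeColouring G K
  toEdgeColouring = record
    { col = λ u v → Maybe.fromMaybe default (χ C u v)
    ; col-sym = λ u v _ → cong (Maybe.fromMaybe default) (χ-sym C u v) }

  χ≡col : ∀ {u v} → adj G u v ≡ true → χ C u v ≡ just (col toEdgeColouring u v)
  χ≡col {u} {v} Euv with χ C u v in χuv
  ... | just _  = refl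
  ... | nothing = case trans (sym (cong is-just χuv)) (trans (χ-domain C u v) Euv) of λ ()

  toEdgeColouring-proper : Proper toEdgeColouring
  toEdgeColouring-proper u v w Euv Euw v≢w same =
    v≢w (χ-proper C u v w _ (χ≡col Euv) (trans (χ≡col Euw) (cong just (sym same))))

  toEdgeColouring-1-factors : (∀ u → Saturated C u) → ∀ i → PerfectMatchingClass toEdgeColouring i
  toEdgeColouring-1-factors saturated i u =
    v , (χ⇒edge C χuv≡i , cong (Maybe.fromMaybe default) χuv≡i) ,
    λ w Euw col≡i → χ-proper C u w v i (trans (χ≡col Euw) (cong just col≡i)) χuv≡i
    where
    v = proj₁ (saturated u i)
    χuv≡i = proj₂ (saturated u i)

∈-irrelevant : ∀ {n} {S : Subset n} {i : Fin n} (p q : i ∈ S) → p ≡ q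
∈-irrelevant here      here      = refl
∈-irrelevant (there p) (there q) = cong there (∈-irrelevant p q)

inside : ∀ {n} → Graph (Fin n) → Subset n → Relation n
inside G S u v = adj G u v ∧ (lookup S u ∧ lookup S v)

module Induced {n} (G : Graph (Fin n)) (S : Subset n) {k : ℕ}
  (C : EdgeColouring (induced G S) k) (1-factors : ∀ i → PerfectMatchingClass C i) where

  private
    χ-cases : ∀ u v a b e → lookup S u ≡ a → lookup S v ≡ b → adj G u v ≡ e → Maybe (Fin k)
    χ-cases u v true true true Su Sv _ = just (col C (u , Vec.lookup⇒[]= u S Su) (v , Vec.lookup⇒[]= v S Sv))
    χ-cases u v _    _    _    _  _  _ = nothing

    χ-cases-domain : ∀ u v a b e Su Sv Euv → is-just (χ-cases u v a b e Su Sv Euv) ≡ e ∧ (a ∧ b)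
    χ-cases-domain u v true  true  true  _ _ _ = refl
    χ-cases-domain u v true  true  false _ _ _ = refl
    χ-cases-domain u v true  false e     _ _ _ = sym (∧-zeroʳ e)
    χ-cases-domain u v false b     e     _ _ _ = sym (∧-zeroʳ e)

    χ-cases-col : ∀ u v a b e Su Sv Euv (p : u ∈ S) (q : v ∈ S) → e ≡ true →
                  χ-cases u v a b e Su Sv Euv ≡ just (col C (u , p) (v , q))
    χ-cases-col u v true true true Su Sv _ p q _
      rewrite ∈-irrelevant (Vec.lookup⇒[]= u S Su) p | ∈-irrelevant (Vec.lookup⇒[]= v S Sv) q = refl
    χ-cases-col u v false _ _ Su _ _ p _ _ = case trans (sym (Vec.[]=⇒lookup p)) Su of λ ()
    χ-cases-col u v true false _ _ Sv _ _ q _ = case trans (sym (Vec.[]=⇒lookup q)) Sv of λ ()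

  χS : Fin n → Fin n → Maybe (Fin k)
  χS u v = χ-cases u v (lookup S u) (lookup S v) (adj G u v) refl refl refl

  χS≡col : ∀ {u v} (p : u ∈ S) (q : v ∈ S) → adj G u v ≡ true → χS u v ≡ just (col C (u , p) (v , q))
  χS≡col p q = χ-cases-col _ _ _ _ _ refl refl refl p q

  χS-domain : ∀ u v → is-just (χS u v) ≡ inside G S u v
  χS-domain u v = χ-cases-domain u v _ _ _ refl refl refl

  inside⇒ : ∀ {u v} → inside G S u v ≡ true → u ∈ S × v ∈ S × adj G u v ≡ true
  inside⇒ {u} {v} uv-inside = let (Euv , Su∧Sv) = ∧-true uv-inside ; (Su , Sv) = ∧-true Su∧Sv in
    Vec.lookup⇒[]= u S Su , Vec.lookup⇒[]= v S Sv , Euv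

  χS-sym : ∀ u v → χS u v ≡ χS v u
  χS-sym u v with inside G S u v in uv-inside
  ... | true  = let (p , q , Euv) = inside⇒ uv-inside in
      trans (χS≡col p q Euv) (trans (cong just (col-sym C (u , p) (v , q) Euv))
                                    (sym (χS≡col q p (trans (adj-sym G v u) Euv))))
  ... | false = trans (off u v uv-inside) (sym (off v u (trans (inside-sym v u) uv-inside)))
    where
    inside-sym : ∀ u v → inside G S u v ≡ inside G S v u
    inside-sym u v = cong₂ _∧_ (adj-sym G u v) (∧-comm (lookup S u) (lookup S v))
    off : ∀ u v → inside G S u v ≡ false → χS u v ≡ nothing
    off u v uv-outside with χS u v in χuv
    ... | nothing = refl
    ... | just _  = case trans (trans (sym (cong is-just χuv)) (χS-domain u v)) uv-outside of λ ()

  χS-proper : ∀ u v w i → χS u v ≡ just i → χS u w ≡ just i → v ≡ w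
  χS-proper u v w i χuv≡i χuw≡i =
    let (p , q , Euv)  = inside⇒ (trans (sym (χS-domain u v)) (cong is-just χuv≡i))
        (_ , q′ , Euw) = inside⇒ (trans (sym (χS-domain u w)) (cong is-just χuw≡i))
        (_ , _ , unique) = 1-factors i (u , p)
    in trans (cong proj₁ (unique (v , q) Euv (Maybe.just-injective (trans (sym (χS≡col p q Euv)) χuv≡i))))
             (sym (cong proj₁ (unique (w , q′) Euw (Maybe.just-injective (trans (sym (χS≡col p q′ Euw)) χuw≡i)))))

  induced-colouring : Colouring k (inside G S)
  induced-colouring = record { χ = χS ; χ-domain = χS-domain ; χ-sym = χS-sym ; χ-proper = χS-proper }

  induced-colouring-saturated : ∀ u → lookup S u ≡ true → Saturated induced-colouring u
  induced-colouring-saturated u Su i =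
    let p = Vec.lookup⇒[]= u S Su
        ((v , q) , (Euv , col≡i) , _) = 1-factors i (u , p)
    in v , trans (χS≡col p q Euv) (cong just col≡i)

reach-crosses : ∀ {n} (G : Graph (Fin n)) (S : Fin n → Bool) {u v} → Reach G u v → S u ≡ true → S v ≡ false →
  Σ (Fin n) λ a → Σ (Fin n) λ b → adj G a b ≡ true × S a ≡ true × S b ≡ false
reach-crosses G S here Su Sv = case trans (sym Su) Sv of λ ()
reach-crosses G S (step {u} {w} Euw w⇝v) Su Sv with S w in Sw
... | true  = reach-crosses G S w⇝v Sw Sv
... | false = u , w , Euw , Su , Sw

-- Bipartitions and double counting

count-∧ : ∀ {n} b (Q : Fin n → Bool) → count (λ v → b ∧ Q v) ≡ iverson b * count Q
count-∧ true  Q = sym (+-identityʳ (count Q))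
count-∧ {n} false Q = count-false {n}

double-counting : ∀ {n} (S : Fin n → Bool) (X : Relation n) →
  (∀ u v → X u v ≡ X v u) → (∀ u v → X u v ≡ true → S u ≡ not (S v)) →
  ∑[ u < n ] (iverson (S u) * count (X u)) ≡ ∑[ v < n ] (iverson (not (S v)) * count (X v))
double-counting {n} S X X-sym X-across = begin
  ∑[ u < n ] (iverson (S u) * count (X u))       ≡⟨ sum-cong-≗ (λ u → sym (count-∧ (S u) (X u))) ⟩
  ∑[ u < n ] ∑[ v < n ] iverson (S u ∧ X u v)   ≡⟨ ∑-comm (λ u v → iverson (S u ∧ X u v)) ⟩
  ∑[ v < n ] ∑[ u < n ] iverson (S u ∧ X u v)   ≡⟨ sum-cong-≗ (λ v → sum-cong-≗ (cong iverson ∘ flip v)) ⟩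
  ∑[ v < n ] count (λ u → not (S v) ∧ X v u)    ≡⟨ sum-cong-≗ (λ v → count-∧ (not (S v)) (X v)) ⟩
  ∑[ v < n ] (iverson (not (S v)) * count (X v)) ∎
  where
  open ≡-Reasoning
  flip : ∀ v u → S u ∧ X u v ≡ not (S v) ∧ X v u
  flip v u with X u v in Xuv
  ... | true  = trans (∧-identityʳ (S u)) (trans (X-across u v Xuv)
                  (sym (trans (cong (not (S v) ∧_) (trans (X-sym v u) Xuv)) (∧-identityʳ _))))
  ... | false = trans (∧-zeroʳ (S u)) (sym (trans (cong (not (S v) ∧_) (trans (X-sym v u) Xuv)) (∧-zeroʳ _)))

iverson-true-* : ∀ {b} → b ≡ true → ∀ x → iverson b * x ≡ x
iverson-true-* refl = +-identityʳ

∑-iverson-const : ∀ {n} (Q : Fin n → Bool) (f : Fin n → ℕ) {c} → (∀ v → Q v ≡ true → f v ≡ c) →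
  ∑[ v < n ] (iverson (Q v) * f v) ≡ count Q * c
∑-iverson-const Q f {c} f≡c = trans (sum-cong-≗ pointwise) (sym (*-distribʳ-sum c (iverson ∘ Q)))
  where
  pointwise : ∀ v → iverson (Q v) * f v ≡ iverson (Q v) * c
  pointwise v with Q v in Qv
  ... | true  = cong (_+ 0) (f≡c v Qv)
  ... | false = refl

∑-iverson-tight-≤ : ∀ {n} (Q : Fin n → Bool) (f : Fin n → ℕ) {c} → (∀ v → Q v ≡ true → f v ≤ c) →
  ∑[ v < n ] (iverson (Q v) * f v) ≡ count Q * c → ∀ v → Q v ≡ true → f v ≡ c
∑-iverson-tight-≤ Q f {c} f≤c ∑≡ v Qv =
  trans (sym (iverson-true-* Qv (f v))) (trans (∑-mono-≤-tight weighted-≤ ∑≥ v) (iverson-true-* Qv c))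
  where
  weighted-≤ : ∀ v → iverson (Q v) * f v ≤ iverson (Q v) * c
  weighted-≤ v with Q v in Qv
  ... | true  = +-monoˡ-≤ 0 (f≤c v Qv)
  ... | false = z≤n
  ∑≥ = ≤-reflexive (trans (∑-iverson-const Q (λ _ → c) (λ _ _ → refl)) (sym ∑≡))

∑-iverson-tight-≥ : ∀ {n} (Q : Fin n → Bool) (f : Fin n → ℕ) {c} → (∀ v → Q v ≡ true → c ≤ f v) →
  ∑[ v < n ] (iverson (Q v) * f v) ≡ count Q * c → ∀ v → Q v ≡ true → f v ≡ c
∑-iverson-tight-≥ Q f {c} c≤f ∑≡ v Qv =
  sym (trans (sym (iverson-true-* Qv c)) (trans (∑-mono-≤-tight weighted-≥ ∑≤ v) (iverson-true-* Qv (f v))))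
  where
  weighted-≥ : ∀ v → iverson (Q v) * c ≤ iverson (Q v) * f v
  weighted-≥ v with Q v in Qv
  ... | true  = +-monoˡ-≤ 0 (c≤f v Qv)
  ... | false = z≤n
  ∑≤ = ≤-reflexive (trans ∑≡ (sym (∑-iverson-const Q (λ _ → c) (λ _ _ → refl))))

balanced-nonempty : ∀ {n} (S : Fin (suc n) → Bool) → count S ≡ count (not ∘ S) → 0 < count S
balanced-nonempty {n} S balanced = n≢0⇒n>0 λ #S≡0 →
  case trans (sym (count-true {suc n})) (trans (count-split (λ _ → true) S)
         (cong₂ _+_ #S≡0 (trans (sym balanced) #S≡0))) of λ ()

module Sides {n} (G : Graph (Fin n)) (S : Fin n → Bool) where

  cross : Relation n
  cross u v = adj G u v ∧ (S u xor S v)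

  inner : Relation n
  inner u v = adj G u v ∧ not (S u xor S v)

  cross-sym : ∀ u v → cross u v ≡ cross v u
  cross-sym u v = cong₂ _∧_ (adj-sym G u v) (xor-comm (S u) (S v))

  cross-across : ∀ u v → cross u v ≡ true → S u ≡ not (S v)
  cross-across u v uv-cross with S u | S v | proj₂ (∧-true {adj G u v} uv-cross)
  ... | true  | false | _ = refl
  ... | false | true  | _ = refl

  cross-bipartite : ∀ u v → cross u v ≡ true → S u ≢ S v
  cross-bipartite u v uv-cross Su≡Sv with S u | S v | proj₂ (∧-true {adj G u v} uv-cross)
  cross-bipartite u v uv-cross () | true  | false | _
  cross-bipartite u v uv-cross () | false | true  | _

  degree-split : ∀ u → count (adj G u) ≡ count (cross u) + count (inner u)
  degree-split u = count-split (adj G u) (λ v → S u xor S v)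

  module Balanced (balanced : count S ≡ count (not ∘ S)) {c}
                  (cross-deg : ∀ u → S u ≡ true → count (cross u) ≡ c) where

    ∑-cross-other-side : ∑[ v < n ] (iverson (not (S v)) * count (cross v)) ≡ count (not ∘ S) * c
    ∑-cross-other-side = begin
      ∑[ v < n ] (iverson (not (S v)) * count (cross v)) ≡⟨ double-counting S cross cross-sym cross-across ⟨
      ∑[ u < n ] (iverson (S u) * count (cross u))       ≡⟨ ∑-iverson-const S (count ∘ cross) cross-deg ⟩
      count S * c                                        ≡⟨ cong (_* c) balanced ⟩
      count (not ∘ S) * c                                ∎
      where open ≡-Reasoning

    cross-other-side-≤ : (∀ v → S v ≡ false → count (cross v) ≤ c) →
                         ∀ v → S v ≡ false → count (cross v) ≡ c
    cross-other-side-≤ ≤c v Sv = ∑-iverson-tight-≤ (not ∘ S) (count ∘ cross)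
      (λ v ¬Sv → ≤c v (trans (sym (not-involutive (S v))) (cong not ¬Sv))) ∑-cross-other-side v (cong not Sv)

    cross-other-side-≥ : (∀ v → S v ≡ false → c ≤ count (cross v)) →
                         ∀ v → S v ≡ false → count (cross v) ≡ c
    cross-other-side-≥ ≥c v Sv = ∑-iverson-tight-≥ (not ∘ S) (count ∘ cross)
      (λ v ¬Sv → ≥c v (trans (sym (not-involutive (S v))) (cong not ¬Sv))) ∑-cross-other-side v (cong not Sv)

    cross-other-side-const : 0 < count (not ∘ S) → ∀ {c′} →
                             (∀ v → S v ≡ false → count (cross v) ≡ c′) → c′ ≡ c
    cross-other-side-const 0<#¬S {c′} ≡c′ = *-cancelˡ-≡ c′ c (count (not ∘ S)) {{>-nonZero 0<#¬S}}
      (trans (sym (∑-iverson-const (not ∘ S) (count ∘ cross)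
                     λ v ¬Sv → ≡c′ v (trans (sym (not-involutive (S v))) (cong not ¬Sv))))
             ∑-cross-other-side)

balanced-sides : ∀ {n} (S : Fin (suc n) → Bool) → count S ≡ count (not ∘ S) →
  Σ (Fin (suc n)) (λ u → S u ≡ true) × Σ (Fin (suc n)) (λ v → S v ≡ false)
balanced-sides S balanced =
  0<count⇒witness S 0<#S , map₂ not-injective (0<count⇒witness (not ∘ S) (subst (0 <_) balanced 0<#S))
  where 0<#S = balanced-nonempty S balanced

-- Regular graphs with halves of equal size

∣∣≡count : ∀ {n} (V : Subset n) → ∣ V ∣ ≡ count (lookup V)
∣∣≡count []          = refl
∣∣≡count (true  ∷ V) = cong suc (∣∣≡count V)
∣∣≡count (false ∷ V) = ∣∣≡count V

lookup-∁ : ∀ {n} (V : Subset n) u → lookup (∁ V) u ≡ not (lookup V u)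
lookup-∁ V u = Vec.lookup-map u not V

balanced-count : ∀ {n} (V : Subset n) → ∣ V ∣ ≡ ∣ ∁ V ∣ → count (lookup V) ≡ count (not ∘ lookup V)
balanced-count V balanced =
  trans (sym (∣∣≡count V)) (trans balanced (trans (∣∣≡count (∁ V)) (count-cong (lookup-∁ V))))

module _ {n} (G : Graph (Fin n)) (V : Subset n) where

  open Sides G (lookup V)

  inner≡inside : ∀ {u} → lookup V u ≡ true → ∀ v → inner u v ≡ inside G V u v
  inner≡inside u∈V v rewrite u∈V with lookup V v
  ... | true  = refl
  ... | false = refl

  inner≡inside-∁ : ∀ {u} → lookup V u ≡ false → ∀ v → inner u v ≡ inside G (∁ V) u v
  inner≡inside-∁ {u} u∉V v rewrite lookup-∁ V u | lookup-∁ V v | u∉V with lookup V v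
  ... | true  = refl
  ... | false = refl

  adj≡inside∨cross : ∀ u v → (inside G V u v ∨ inside G (∁ V) u v) ∨ cross u v ≡ adj G u v
  adj≡inside∨cross u v rewrite lookup-∁ V u | lookup-∁ V v with adj G u v | lookup V u | lookup V v
  ... | true  | true  | true  = refl
  ... | true  | true  | false = refl
  ... | true  | false | true  = refl
  ... | true  | false | false = refl
  ... | false | _     | _     = refl

  cross⇒¬inside : ∀ u v → cross u v ≡ true → (inside G V u v ∨ inside G (∁ V) u v) ≡ false
  cross⇒¬inside u v uv-cross rewrite lookup-∁ V u | lookup-∁ V v
    with adj G u v | lookup V u | lookup V v | uv-cross
  ... | true  | true  | false | _  = refl
  ... | true  | false | true  | _  = refl
  ... | true  | true  | true  | ()
  ... | true  | false | false | ()
  ... | false | _     | _     | ()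

  glue-1-factorisations : ∀ {k c} (C₁ : Colouring k (inside G V)) (C₂ : Colouring k (inside G (∁ V)))
    (X : Colouring c cross) → (∀ u → lookup V u ≡ true → Saturated C₁ u) →
    (∀ u → lookup V u ≡ false → Saturated C₂ u) → (∀ u → Saturated X u) → Fin (k + c) → OneFactorable G
  glue-1-factorisations {k} {c} C₁ C₂ X sat₁ sat₂ satX default =
    k + c , toEdgeColouring G C default , toEdgeColouring-1-factors G C default saturated
    where
    inside⊆V : ∀ u v → inside G V u v ≡ true → lookup V u ≡ true
    inside⊆V u v = proj₁ ∘ ∧-true ∘ proj₂ ∘ ∧-true {adj G u v}
    inside⊆∁V : ∀ u v → inside G (∁ V) u v ≡ true → lookup V u ≡ false
    inside⊆∁V u v uv-inside = trans (sym (not-involutive _))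
      (cong not (trans (sym (lookup-∁ V u)) (proj₁ (∧-true (proj₂ (∧-true {adj G u v} uv-inside))))))
    inner-colouring = side-union (lookup V) C₁ C₂ inside⊆V inside⊆∁V
    C : Colouring (k + c) (adj G)
    C = colouring-cong adj≡inside∨cross (merge inner-colouring X)
    saturated : ∀ u → Saturated C u
    saturated u = merge-saturated inner-colouring X cross⇒¬inside u
                    (side-union-saturated (lookup V) C₁ C₂ inside⊆V inside⊆∁V sat₁ sat₂ u) (satX u)

-- Adding M ∸ a to both sides turns a + b into M + b ≡ b modulo M.
+-cancelˡ-% : ∀ m {a b b′} → a < suc m → b < suc m → b′ < suc m →
              (a + b) % suc m ≡ (a + b′) % suc m → b ≡ b′
+-cancelˡ-% m {a} {b} {b′} a<M b<M b′<M ≡mod = trans (sym (shift b b<M)) (trans shifted (shift b′ b′<M))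
  where
  M = suc m
  shift : ∀ y → y < M → (M ∸ a + (a + y)) % M ≡ y
  shift y y<M = trans (cong (_% M) (trans (sym (+-assoc (M ∸ a) a y))
                        (trans (cong (_+ y) (m∸n+n≡m (<⇒≤ a<M))) (+-comm M y))))
                  (trans ([m+n]%n≡m%n y M) (m<n⇒m%n≡m y<M))
  shifted : (M ∸ a + (a + b)) % M ≡ (M ∸ a + (a + b′)) % M
  shifted = trans (%-distribˡ-+ (M ∸ a) (a + b) M)
              (trans (cong (λ z → (((M ∸ a) % M) + z) % M) ≡mod) (sym (%-distribˡ-+ (M ∸ a) (a + b′) M)))

module MatchingColouring {n} (G : Graph (Fin n)) (S : Fin n → Bool) {m c : ℕ} (#S≡1+m : count S ≡ suc m)
  (X : Colouring (suc c) (Sides.cross G S)) (X-saturated : ∀ u → Saturated X u) where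

  open Sides G S

  partner : Fin n → Fin n
  partner u = proj₁ (X-saturated u zero)

  partner-χ : ∀ u → χ X u (partner u) ≡ just zero
  partner-χ u = proj₂ (X-saturated u zero)

  partner-unique : ∀ {u v} → χ X u v ≡ just zero → v ≡ partner u
  partner-unique {u} {v} χuv = χ-proper X u v (partner u) zero χuv (partner-χ u)

  partner-involutive : ∀ u → partner (partner u) ≡ u
  partner-involutive u = sym (partner-unique (trans (χ-sym X (partner u) u) (partner-χ u)))

  partner-side : ∀ u → S (partner u) ≡ not (S u)
  partner-side u =
    trans (sym (not-involutive _)) (cong not (sym (cross-across u (partner u) (χ⇒edge X (partner-χ u)))))

  representative : Fin n → Fin n
  representative u = if S u then u else partner u

  representative∈S : ∀ u → S (representative u) ≡ true
  representative∈S u with S u in Su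
  ... | true  = Su
  ... | false = trans (partner-side u) (cong not Su)

  representative-partner : ∀ u → representative (partner u) ≡ representative u
  representative-partner u with S u in Su
  ... | true  rewrite partner-side u | Su = partner-involutive u
  ... | false rewrite partner-side u | Su = refl

  representative-injective : ∀ {u v} → S u ≡ S v → representative u ≡ representative v → u ≡ v
  representative-injective {u} {v} Su≡Sv rep≡ with S u | S v
  ... | true  | true  = rep≡
  ... | false | false = trans (sym (partner-involutive u)) (trans (cong partner rep≡) (partner-involutive v))

  label : Fin n → ℕ
  label = rank S ∘ representative

  label<1+m : ∀ u → label u < suc m
  label<1+m u = subst (label u <_) #S≡1+m (rank<count S (representative∈S u))

  label-partner : ∀ u → label (partner u) ≡ label u
  label-partner u = cong (rank S) (representative-partner u)

  label-injective : ∀ {u v} → S u ≡ S v → label u ≡ label v → u ≡ v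
  label-injective {u} {v} Su≡Sv label≡ = representative-injective Su≡Sv
    (rank-injective S (representative∈S u) (representative∈S v) label≡)

  matched : Maybe (Fin (suc c)) → Bool
  matched (just zero) = true
  matched _           = false

  inner-or-matched : Relation n
  inner-or-matched u v = adj G u v ∧ (not (S u xor S v) ∨ matched (χ X u v))

  inner-or-matched-sym : ∀ u v → inner-or-matched u v ≡ inner-or-matched v u
  inner-or-matched-sym u v =
    cong₂ _∧_ (adj-sym G u v) (cong₂ _∨_ (cong not (xor-comm (S u) (S v))) (cong matched (χ-sym X u v)))

  inner-or-matched-cases : ∀ u v → inner-or-matched u v ≡ true → S u ≡ S v ⊎ v ≡ partner u
  inner-or-matched-cases u v uv-edge with ∨-true (proj₂ (∧-true {adj G u v} uv-edge))
  ... | inj₁ same = inj₁ (same-side (S u) (S v) same)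
    where
    same-side : ∀ a b → not (a xor b) ≡ true → a ≡ b
    same-side true  true  _ = refl
    same-side false false _ = refl
  ... | inj₂ zero-edge with χ X u v in χuv
  ...   | just zero = inj₂ (partner-unique χuv)

  χᴹ : Fin n → Fin n → Maybe (Fin (suc m))
  χᴹ u v = if inner-or-matched u v then just ((label u + label v) mod suc m) else nothing

  χᴹ-just : ∀ {u v i} → χᴹ u v ≡ just i → inner-or-matched u v ≡ true × toℕ i ≡ (label u + label v) % suc m
  χᴹ-just {u} {v} χuv with inner-or-matched u v
  χᴹ-just refl | true = refl , Fin.toℕ-fromℕ< _

  χᴹ-proper : ∀ u v w i → χᴹ u v ≡ just i → χᴹ u w ≡ just i → v ≡ w
  χᴹ-proper u v w i χuv χuw with χᴹ-just {u} {v} χuv | χᴹ-just {u} {w} χuw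
  ... | uv-edge , i≡uv | uw-edge , i≡uw =
    match (inner-or-matched-cases u v uv-edge) (inner-or-matched-cases u w uw-edge)
    where
    label≡ : label v ≡ label w
    label≡ = +-cancelˡ-% m (label<1+m u) (label<1+m v) (label<1+m w) (trans (sym i≡uv) i≡uw)
    no-loop : ∀ {z} → S u ≡ S z → label z ≡ label u → adj G u z ≡ true → ⊥
    no-loop Su≡Sz label-z Euz with label-injective Su≡Sz (sym label-z)
    ... | refl = case trans (sym Euz) (irrefl G u) of λ ()
    match : S u ≡ S v ⊎ v ≡ partner u → S u ≡ S w ⊎ w ≡ partner u → v ≡ w
    match (inj₁ Sv) (inj₁ Sw) = label-injective (trans (sym Sv) Sw) label≡
    match (inj₂ v≡) (inj₂ w≡) = trans v≡ (sym w≡)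
    match (inj₁ Sv) (inj₂ w≡) =
      ⊥-elim (no-loop Sv (trans label≡ (trans (cong label w≡) (label-partner u))) (proj₁ (∧-true uv-edge)))
    match (inj₂ v≡) (inj₁ Sw) =
      ⊥-elim (no-loop Sw (trans (sym label≡) (trans (cong label v≡) (label-partner u))) (proj₁ (∧-true uw-edge)))

  χᴹ-domain : ∀ u v → is-just (χᴹ u v) ≡ inner-or-matched u v
  χᴹ-domain u v with inner-or-matched u v
  ... | true  = refl
  ... | false = refl

  χᴹ-sym : ∀ u v → χᴹ u v ≡ χᴹ v u
  χᴹ-sym u v rewrite inner-or-matched-sym u v | +-comm (label u) (label v) = refl

  inner-or-matched-colouring : Colouring (suc m) inner-or-matched
  inner-or-matched-colouring = record { χ = χᴹ ; χ-domain = χᴹ-domain ; χ-sym = χᴹ-sym ; χ-proper = χᴹ-proper }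

  unmatched-cross : Relation n
  unmatched-cross u v = is-just (shift-down (χ X u v))

  adj≡inner-or-matched∨unmatched : ∀ u v → inner-or-matched u v ∨ unmatched-cross u v ≡ adj G u v
  adj≡inner-or-matched∨unmatched u v with adj G u v in Euv | S u xor S v in across
  ... | false | _     rewrite non-edge⇒χ X {u} {v} (cong (_∧ _) Euv) = refl
  ... | true  | false = refl
  ... | true  | true  with edge⇒χ X {u} {v} (trans (cong₂ _∧_ Euv across) refl)
  ...   | zero  , χuv rewrite χuv = refl
  ...   | suc _ , χuv rewrite χuv = refl

  matching-colouring : Colouring (suc m + c) (adj G)
  matching-colouring = colouring-cong adj≡inner-or-matched∨unmatched
    (merge inner-or-matched-colouring (drop-colour-zero X))

module _ {n} (G : Graph (Fin n)) (V : Subset n) (balanced : count (lookup V) ≡ count (not ∘ lookup V))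
         {d} (regular : ∀ u → count (adj G u) ≡ d) where

  private
    S = lookup V
  open Sides G S

  inner⇒same-side : ∀ {u v} → inner u v ≡ true → S u ≡ S v
  inner⇒same-side {u} {v} uv-inner with S u | S v | proj₂ (∧-true {adj G u v} uv-inner)
  ... | true  | true  | _ = refl
  ... | false | false | _ = refl

  cross+inner : ∀ u → count (cross u) + count (inner u) ≡ d
  cross+inner u = trans (sym (degree-split u)) (regular u)

  cross≡d∸inner : ∀ {u k} → count (inner u) ≡ k → count (cross u) ≡ d ∸ k
  cross≡d∸inner {u} {k} inner≡k = trans (sym (m+n∸n≡m (count (cross u)) k))
    (cong (_∸ k) (trans (cong (count (cross u) +_) (sym inner≡k)) (cross+inner u)))

  inner-degrees-agree : ∀ {k₁ k₂ u₁ u₂} → S u₁ ≡ true → S u₂ ≡ false →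
    (∀ u → S u ≡ true → count (inner u) ≡ k₁) → (∀ u → S u ≡ false → count (inner u) ≡ k₂) →
    k₂ ≡ k₁ × (∀ u → count (cross u) ≡ d ∸ k₁)
  inner-degrees-agree {k₁} {k₂} {u₁} {u₂} u₁∈V u₂∉V inner₁ inner₂ =
    k₂≡k₁ , both-sides S cross₁ (λ u u∉V → trans (cross≡d∸inner (inner₂ u u∉V)) c₂≡c₁)
    where
    cross₁ : ∀ u → S u ≡ true → count (cross u) ≡ d ∸ k₁
    cross₁ u = cross≡d∸inner ∘ inner₁ u
    c₂≡c₁ : d ∸ k₂ ≡ d ∸ k₁
    c₂≡c₁ = Balanced.cross-other-side-const balanced cross₁ (0<count (not ∘ S) u₂ (cong not u₂∉V))
              λ u → cross≡d∸inner ∘ inner₂ u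
    k₂≡k₁ : k₂ ≡ k₁
    k₂≡k₁ = +-cancelˡ-≡ (d ∸ k₁) k₂ k₁ (begin
      d ∸ k₁ + k₂                         ≡⟨ cong (_+ k₂) c₂≡c₁ ⟨
      d ∸ k₂ + k₂                         ≡⟨ cong₂ _+_ (cross≡d∸inner (inner₂ u₂ u₂∉V)) (inner₂ u₂ u₂∉V) ⟨
      count (cross u₂) + count (inner u₂) ≡⟨ trans (cross+inner u₂) (sym (cross+inner u₁)) ⟩
      count (cross u₁) + count (inner u₁) ≡⟨ cong₂ _+_ (cross₁ u₁ u₁∈V) (inner₁ u₁ u₁∈V) ⟩
      d ∸ k₁ + k₁                         ∎)
      where open ≡-Reasoning

  coclique-inner-degree : IsCoclique G V → ∀ u → S u ≡ true → count (inner u) ≡ 0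
  coclique-inner-degree coclique u u∈V = n≤0⇒n≡0 (subst (count (inner u) ≤_) (count-false {n})
    (count-mono (inner u) (λ _ → false) λ v uv-inner →
      trans (sym (coclique u v (Vec.lookup⇒[]= u V u∈V)
                                 (Vec.lookup⇒[]= v V (trans (sym (inner⇒same-side uv-inner)) u∈V))))
            (proj₁ (∧-true uv-inner))))

  coclique-colouring : IsCoclique G V → Colouring d (adj G)
  coclique-colouring coclique = konig d S (adj G) (adj-sym G) bipartite (≤-reflexive ∘ regular)
    where
    cross₁ : ∀ u → S u ≡ true → count (cross u) ≡ d
    cross₁ u = cross≡d∸inner ∘ coclique-inner-degree coclique u
    cross-regular : ∀ u → count (cross u) ≡ d
    cross-regular = both-sides S cross₁ (Balanced.cross-other-side-≤ balanced cross₁ λ v _ →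
      subst (count (cross v) ≤_) (cross+inner v) (m≤m+n (count (cross v)) (count (inner v))))
    no-inner : ∀ u → count (inner u) ≡ 0
    no-inner u = +-cancelˡ-≡ d (count (inner u)) 0
      (trans (cong (_+ count (inner u)) (sym (cross-regular u))) (trans (cross+inner u) (sym (+-identityʳ d))))
    bipartite : ∀ u v → adj G u v ≡ true → S u ≢ S v
    bipartite u v Euv Su≡Sv = <-irrefl (sym (no-inner u))
      (0<count (inner u) v (cong₂ _∧_ Euv (cong not (trans (cong (_xor S v) Su≡Sv) (xor-same (S v))))))

  clique-inner-degree : IsClique G V → ∀ {m} → count S ≡ suc m → ∀ u → S u ≡ true → count (inner u) ≡ m
  clique-inner-degree clique #S≡1+m u u∈V =
    trans (count-cong inner≡others) (suc-injective (trans (sym (count-remove S u u∈V)) #S≡1+m))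
    where
    inner≡others : ∀ v → inner u v ≡ (S ─ u) v
    inner≡others v with S v in v∈V | v ≟ u
    ... | false | _        rewrite u∈V = ∧-zeroʳ (adj G u v)
    ... | true  | yes refl rewrite u∈V = trans (∧-identityʳ (adj G u u)) (irrefl G u)
    ... | true  | no  v≢u  rewrite u∈V =
      trans (∧-identityʳ (adj G u v)) (clique u v (Vec.lookup⇒[]= u V u∈V) (Vec.lookup⇒[]= v V v∈V) (v≢u ∘ sym))

  inner-degree-≤ : ∀ {m} → count S ≡ suc m → ∀ u → S u ≡ false → count (inner u) ≤ m
  inner-degree-≤ #S≡1+m u u∉V = subst (count (inner u) ≤_)
    (suc-injective (trans (sym (count-remove (not ∘ S) u (cong not u∉V))) (trans (sym balanced) #S≡1+m)))
    (count-mono (inner u) ((not ∘ S) ─ u) λ v uv-inner →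
      ─-true (not ∘ S) (cong not (trans (sym (inner⇒same-side uv-inner)) u∉V))
        λ { refl → case trans (sym (proj₁ (∧-true uv-inner))) (irrefl G u) of λ () })

  clique-colouring : IsClique G V → ∀ {a b} → S a ≡ true → cross a b ≡ true → Colouring d (adj G)
  clique-colouring clique {a} {b} a∈V ab-cross = subst (λ k → Colouring k (adj G)) colours≡d matching-colouring
    where
    m = pred (count S)
    #S≡1+m : count S ≡ suc m
    #S≡1+m = sym (suc-pred (count S) {{>-nonZero (0<count S a a∈V)}})
    inner₁ = clique-inner-degree clique #S≡1+m
    cross₁ : ∀ u → S u ≡ true → count (cross u) ≡ d ∸ m
    cross₁ u = cross≡d∸inner ∘ inner₁ u
    cross₂ : ∀ u → S u ≡ false → d ∸ m ≤ count (cross u)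
    cross₂ u u∉V = m≤n+o⇒m∸n≤o d m (subst (_≤ m + count (cross u)) (cross+inner u)
      (subst (count (cross u) + count (inner u) ≤_) (+-comm (count (cross u)) m)
        (+-monoʳ-≤ (count (cross u)) (inner-degree-≤ #S≡1+m u u∉V))))
    cross-regular : ∀ u → count (cross u) ≡ d ∸ m
    cross-regular = both-sides S cross₁ (Balanced.cross-other-side-≥ balanced cross₁ cross₂)

    c = pred (d ∸ m)
    cross-regular′ : ∀ u → count (cross u) ≡ suc c
    cross-regular′ u = trans (cross-regular u)
      (sym (suc-pred (d ∸ m) {{>-nonZero (subst (0 <_) (cross-regular a) (0<count (cross a) b ab-cross))}}))
    X : Colouring (suc c) cross
    X = konig (suc c) S cross cross-sym cross-bipartite (≤-reflexive ∘ cross-regular′)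
    open MatchingColouring G S #S≡1+m X (λ u → degree≡⇒saturated X u (cross-regular′ u))

    colours≡d : suc m + c ≡ d
    colours≡d = trans (cong suc (+-comm m c))
      (trans (cong₂ _+_ (sym (cross-regular′ a)) (sym (inner₁ a a∈V))) (cross+inner a))

halves-1-factorable : ∀ {n} (G : Graph (Fin n)) → Regular G → (V : Subset n) → ∣ V ∣ ≡ ∣ ∁ V ∣ →
  OneFactorable (induced G V) → OneFactorable (induced G (∁ V)) → OneFactorable G
halves-1-factorable {zero} G _ _ _ _ _ = 0 , record { col = λ () ; col-sym = λ () } , λ ()
halves-1-factorable {suc n} G (d , regular) V ∣V∣≡∣∁V∣ (k₁ , F₁ , 1-factors₁) (k₂ , F₂ , 1-factors₂)
  with balanced-count V ∣V∣≡∣∁V∣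
... | balanced with balanced-sides (lookup V) balanced
... | (u₁ , u₁∈V) , (u₂ , u₂∉V) =
  glue-1-factorisations G V I₁.induced-colouring (proj₁ C₂) X sat₁ (proj₂ C₂) satX default
  where
  S = lookup V
  open Sides G S
  module I₁ = Induced G V F₁ 1-factors₁
  module I₂ = Induced G (∁ V) F₂ 1-factors₂

  sat₁ : ∀ u → S u ≡ true → Saturated I₁.induced-colouring u
  sat₁ = I₁.induced-colouring-saturated
  sat₂ : ∀ u → S u ≡ false → Saturated I₂.induced-colouring u
  sat₂ u u∉V = I₂.induced-colouring-saturated u (trans (lookup-∁ V u) (cong not u∉V))

  inner₁ : ∀ u → S u ≡ true → count (inner u) ≡ k₁
  inner₁ u u∈V = trans (count-cong (inner≡inside G V u∈V))
                   (saturated⇒degree≡ I₁.induced-colouring u (sat₁ u u∈V))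
  inner₂ : ∀ u → S u ≡ false → count (inner u) ≡ k₂
  inner₂ u u∉V = trans (count-cong (inner≡inside-∁ G V u∉V))
                   (saturated⇒degree≡ I₂.induced-colouring u (sat₂ u u∉V))

  agree : k₂ ≡ k₁ × (∀ u → count (cross u) ≡ d ∸ k₁)
  agree = inner-degrees-agree G V balanced (λ u → trans (sym (degree≡count G u)) (regular u))
            u₁∈V u₂∉V inner₁ inner₂

  C₂ : Σ (Colouring k₁ (inside G (∁ V))) λ C → ∀ u → S u ≡ false → Saturated C u
  C₂ = subst (λ k → Σ (Colouring k (inside G (∁ V))) λ C → ∀ u → S u ≡ false → Saturated C u) (proj₁ agree)
         (I₂.induced-colouring , sat₂)

  X : Colouring (d ∸ k₁) cross
  X = konig (d ∸ k₁) S cross cross-sym cross-bipartite (≤-reflexive ∘ proj₂ agree)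

  satX : ∀ u → Saturated X u
  satX u = degree≡⇒saturated X u (proj₂ agree u)

  -- col F₁ is total, so its value at the non-edge u₁u₁ shows that Fin k₁ is inhabited.
  default : Fin (k₁ + (d ∸ k₁))
  default = col F₁ (u₁ , Vec.lookup⇒[]= u₁ V u₁∈V) (u₁ , Vec.lookup⇒[]= u₁ V u₁∈V) ↑ˡ (d ∸ k₁)

class1-of-colouring : ∀ {n} (G : Graph (Fin (suc n))) {d} → (∀ v → degree G v ≡ d) →
  Colouring d (adj G) → Fin d → Class1 G
class1-of-colouring G regular C default =
  subst (EdgeColourable G) (sym (maxDegree-regular G regular))
    (toEdgeColouring G C default , toEdgeColouring-proper G C default) ,
  maxDegree≤colours G

clique-or-coclique⇒class1 : ∀ {n} (G : Graph (Fin n)) → Connected G → Regular G → (V : Subset n) →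
  ∣ V ∣ ≡ ∣ ∁ V ∣ → IsClique G V ⊎ IsCoclique G V → Class1 G
clique-or-coclique⇒class1 {zero} G _ _ _ _ _ =
  (record { col = λ () ; col-sym = λ () } , λ ()) , maxDegree≤colours G
clique-or-coclique⇒class1 {suc n} G connected (d , regular) V ∣V∣≡∣∁V∣ clique-or-coclique
  with balanced-count V ∣V∣≡∣∁V∣
... | balanced with balanced-sides (lookup V) balanced
... | (u , u∈V) , (v , v∉V) with reach-crosses G (lookup V) (connected u v) u∈V v∉V
... | a , b , Eab , a∈V , b∉V = class1-of-colouring G regular C (proj₁ (edge⇒χ C Eab))
  where
  regular′ : ∀ u → count (adj G u) ≡ d
  regular′ u = trans (sym (degree≡count G u)) (regular u)
  C : Colouring d (adj G)
  C = [ (λ clique → clique-colouring G V balanced regular′ clique a∈V (cong₂ _∧_ Eab (cong₂ _xor_ a∈V b∉V)))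
      , coclique-colouring G V balanced regular′ ]′ clique-or-coclique

lemma2p2 : (n : ℕ) (G : Graph (Fin n)) → Connected G → Regular G → 2 ∣ n →
    (V₁ V₂ : Subset n) → V₂ ≡ ∁ V₁ → ∣ V₁ ∣ ≡ n / 2 → ∣ V₂ ∣ ≡ n / 2 →
    ((OneFactorable (induced G V₁) × OneFactorable (induced G V₂) → OneFactorable G)
    × (IsClique G V₁ ⊎ IsCoclique G V₁ → Class1 G))
lemma2p2 n G connected regular _ V₁ .(∁ V₁) refl ∣V₁∣≡n/2 ∣V₂∣≡n/2 =
  (λ (F₁ , F₂) → halves-1-factorable G regular V₁ balanced F₁ F₂) ,
  clique-or-coclique⇒class1 G connected regular V₁ balanced
  where
  balanced : ∣ V₁ ∣ ≡ ∣ ∁ V₁ ∣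
  balanced = trans ∣V₁∣≡n/2 (sym ∣V₂∣≡n/2)
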